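{- For every value $v$, heaps $h,h'$, ground type $\tau$ and $w$: if $h|_{R(h,v)}=h'|_{R(h,v)}$ and $v\models^h_\tau w$, then $v\models^{h'}_\tau w$.
   Context: Values are $v::=c\mid\ell\mid\mathtt{NULL}$ ($c$ an integer, $\ell$ a location). A heap is a finite partial map from locations to partial maps $\{\mathtt{hd},\mathtt{tl}\}\rightharpoonup$ values; $h.\ell.\mathtt{hd}$, $h.\ell.\mathtt{tl}$ are the stored values, $h|_X$ is restriction of $h$ to a set $X$ of locations, $h\setminus\ell$ is $h$ with $\ell$ removed from its domain. The footprint: $R(h,c)=R(h,\mathtt{NULL})=\emptyset$, $R(h,\ell)=\emptyset$ if $\ell\notin\mathrm{dom}\,h$, otherwise $R(h,\ell)=\{\ell\}\cup R(h\setminus\ell,h.\ell.\mathtt{hd})\cup R(h\setminus\ell,h.\ell.\mathtt{tl})$. Ground types: $\tau::=\mathtt{Int}\mid[\tau]^{n}$ with $n$ a natural number. The relation $v\models^h_\tau w$ is defined by: $c\models^h_{\mathtt{Int}}c$; $\mathtt{NULL}\models^h_{[\tau]^0}[\,]$; $\ell\models^h_{[\tau]^n}w_{hd}::w_{tl}$ iff $n\ge1$, $\ell\in\mathrm{dom}\,h$, $h.\ell.\mathtt{hd}\models^{h\setminus\ell}_{\tau}w_{hd}$ and $h.\ell.\mathtt{tl}\models^{h\setminus\ell}_{[\tau]^{n-1}}w_{tl}$; nothing else holds. -}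

module Defs where

open import Data.Nat using (ℕ; zero; suc)
open import Data.Integer using (ℤ)
open import Data.Maybe using (Maybe; just; nothing)
open import Data.Product using (_×_; _,_; proj₁)
open import Data.List using (List; []; _∷_; filter)
open import Data.Bool using (Bool; true; false; if_then_else_)
open import Relation.Nullary using (¬_)
open import Relation.Nullary.Decidable using (⌊_⌋)
open import Relation.Binary.PropositionalEquality using (_≡_)
import Data.Nat as N

Loc : Set
Loc = ℕ

data Val : Set where
  int  : ℤ → Val
  loc  : Loc → Val
  NULL : Val

-- A cell is a partial map {hd, tl} ⇀ Val, i.e. an optional hd and an optional tl.
record Cell : Set where
  constructor cell
  field
    hd : Maybe Val
    tl : Maybe Val
open Cell public

-- A heap is a finite partial map Loc ⇀ Cell, represented by a finite
-- association list (the first binding of a location is the relevant one).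
Heap : Set
Heap = List (Loc × Cell)

_·_ : Heap → Loc → Maybe Cell
[] · ℓ = nothing
((k , c) ∷ h) · ℓ = if ⌊ k N.≟ ℓ ⌋ then just c else (h · ℓ)

_∈dom_ : Loc → Heap → Set
ℓ ∈dom h = ¬ (h · ℓ ≡ nothing)

_∖_ : Heap → Loc → Heap
[] ∖ ℓ = []
((k , c) ∷ h) ∖ ℓ = if ⌊ k N.≟ ℓ ⌋ then (h ∖ ℓ) else ((k , c) ∷ (h ∖ ℓ))

-- Membership in the footprint R(h, v), as the inductive (least) reading of
-- the recursive definition R(h,ℓ) = {ℓ} ∪ R(h∖ℓ, h.ℓ.hd) ∪ R(h∖ℓ, h.ℓ.tl)
-- for ℓ ∈ dom h, and ∅ otherwise (R(h,c) = R(h,NULL) = ∅).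
-- An undefined field contributes nothing.
data _∈R[_,_] : Loc → Heap → Maybe Val → Set where
  here   : ∀ {h ℓ c} → h · ℓ ≡ just c → ℓ ∈R[ h , just (loc ℓ) ]
  viaHd  : ∀ {h ℓ c ℓ'} → h · ℓ ≡ just c → ℓ' ∈R[ h ∖ ℓ , hd c ] →
           ℓ' ∈R[ h , just (loc ℓ) ]
  viaTl  : ∀ {h ℓ c ℓ'} → h · ℓ ≡ just c → ℓ' ∈R[ h ∖ ℓ , tl c ] →
           ℓ' ∈R[ h , just (loc ℓ) ]

R : Heap → Val → Loc → Set
R h v ℓ = ℓ ∈R[ h , just v ]

-- Equality of restrictions h|_X = h'|_X as partial maps Loc ⇀ Cell:
-- they agree on every ℓ ∈ X (outside X both are undefined).
RestrictEq : Heap → Heap → (Loc → Set) → Set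
RestrictEq h h' X = ∀ ℓ → X ℓ → h · ℓ ≡ h' · ℓ

data Ty : Set where
  Int  : Ty
  [_]^_ : Ty → ℕ → Ty

data MVal : Set where
  mint : ℤ → MVal
  []   : MVal
  _::_ : MVal → MVal → MVal

data _⊨[_,_]_ : Val → Heap → Ty → MVal → Set where
  ⊨int  : ∀ {h c} → int c ⊨[ h , Int ] mint c
  ⊨nil  : ∀ {h τ} → NULL ⊨[ h , [ τ ]^ 0 ] []
  ⊨cons : ∀ {h τ n ℓ c vhd vtl whd wtl} →
          h · ℓ ≡ just c → hd c ≡ just vhd → tl c ≡ just vtl →
          vhd ⊨[ h ∖ ℓ , τ ] whd →
          vtl ⊨[ h ∖ ℓ , [ τ ]^ n ] wtl →
          loc ℓ ⊨[ h , [ τ ]^ suc n ] (whd :: wtl)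

module Submission where

-- Integer and NULL
-- values do not look at the heap at all.  For a cell ℓ, agreement on R(h,ℓ)
-- contains ℓ itself, so h' stores the same cell at ℓ; the fields are then
-- represented in h∖ℓ, and we must pass to h'∖ℓ.  Two facts make this work:
--   * deletion commutes with agreement: if h and h' agree on X, then so do
--     h∖ℓ and h'∖ℓ (at ℓ both are undefined, elsewhere nothing changed);
--   * the footprints R(h∖ℓ, hd) and R(h∖ℓ, tl) of the stored fields are
--     contained in R(h,ℓ), and agreement on a set implies agreement on any
--     subset.

open import Defs
open import Data.Nat using (_≟_)
open import Data.Maybe using (just; nothing)
open import Data.Product using (_,_)
open import Data.List using ([]; _∷_)
open import Data.Empty using (⊥-elim)
open import Relation.Nullary using (yes; no; ¬_)
open import Relation.Unary using (_⊆_)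
open import Relation.Binary.PropositionalEquality
  using (_≡_; refl; sym; trans; subst; module ≡-Reasoning)
open ≡-Reasoning

-- A deleted location is no longer in the domain.  (In the `no` case the
-- lookup in the retained cons cell tests the same key again.)
lookup-∖-same : ∀ h ℓ → (h ∖ ℓ) · ℓ ≡ nothing
lookup-∖-same [] ℓ = refl
lookup-∖-same ((k , c) ∷ h) ℓ with k ≟ ℓ
... | yes _ = lookup-∖-same h ℓ
... | no k≢ℓ with k ≟ ℓ
...   | yes k≡ℓ = ⊥-elim (k≢ℓ k≡ℓ)
...   | no _ = lookup-∖-same h ℓ

lookup-∖-other : ∀ h ℓ k → ¬ k ≡ ℓ → (h ∖ ℓ) · k ≡ h · k
lookup-∖-other [] ℓ k _ = refl
lookup-∖-other ((j , c) ∷ h) ℓ k k≢ℓ with j ≟ ℓ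
... | yes refl with j ≟ k
...   | yes refl = ⊥-elim (k≢ℓ refl)
...   | no _ = lookup-∖-other h ℓ k k≢ℓ
lookup-∖-other ((j , c) ∷ h) ℓ k k≢ℓ | no _ with j ≟ k
...   | yes _ = refl
...   | no _ = lookup-∖-other h ℓ k k≢ℓ

restrictEq-mono : ∀ h h' {X Y} → Y ⊆ X → RestrictEq h h' X → RestrictEq h h' Y
restrictEq-mono _ _ Y⊆X agree k k∈Y = agree k (Y⊆X k∈Y)

restrictEq-∖ : ∀ h h' {X} ℓ → RestrictEq h h' X → RestrictEq (h ∖ ℓ) (h' ∖ ℓ) X
restrictEq-∖ h h' ℓ agree k k∈X with k ≟ ℓ
... | yes refl = trans (lookup-∖-same h k) (sym (lookup-∖-same h' k))
... | no k≢ℓ = begin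
  (h ∖ ℓ) · k   ≡⟨ lookup-∖-other h ℓ k k≢ℓ ⟩
  h · k         ≡⟨ agree k k∈X ⟩
  h' · k        ≡⟨ sym (lookup-∖-other h' ℓ k k≢ℓ) ⟩
  (h' ∖ ℓ) · k  ∎

hd-footprint⊆ : ∀ {h ℓ c v} → h · ℓ ≡ just c → hd c ≡ just v →
  R (h ∖ ℓ) v ⊆ R h (loc ℓ)
hd-footprint⊆ hℓ hd≡v k∈ = viaHd hℓ (subst (λ m → _ ∈R[ _ , m ]) (sym hd≡v) k∈)

tl-footprint⊆ : ∀ {h ℓ c v} → h · ℓ ≡ just c → tl c ≡ just v →
  R (h ∖ ℓ) v ⊆ R h (loc ℓ)
tl-footprint⊆ hℓ tl≡v k∈ = viaTl hℓ (subst (λ m → _ ∈R[ _ , m ]) (sym tl≡v) k∈)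

lemma6p5 : (v : Val) (h h' : Heap) (τ : Ty) (w : MVal) →
    RestrictEq h h' (R h v) → v ⊨[ h , τ ] w → v ⊨[ h' , τ ] w
lemma6p5 _ _ _ _ _ _ ⊨int = ⊨int
lemma6p5 _ _ _ _ _ _ ⊨nil = ⊨nil
lemma6p5 (loc ℓ) h h' ([ τ ]^ _) _ agree
         (⊨cons {c = c} {vhd = vhd} {vtl = vtl} hℓ hd≡ tl≡ ⊨hd ⊨tl) =
  ⊨cons h'ℓ hd≡ tl≡
    (lemma6p5 vhd (h ∖ ℓ) (h' ∖ ℓ) τ _ (agreeBelow (hd-footprint⊆ hℓ hd≡)) ⊨hd)
    (lemma6p5 vtl (h ∖ ℓ) (h' ∖ ℓ) _ _ (agreeBelow (tl-footprint⊆ hℓ tl≡)) ⊨tl)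
  where
  -- ℓ is in its own footprint, so h' stores the same cell there.
  h'ℓ : h' · ℓ ≡ just c
  h'ℓ = trans (sym (agree ℓ (here hℓ))) hℓ
  agreeBelow : ∀ {Y} → Y ⊆ R h (loc ℓ) → RestrictEq (h ∖ ℓ) (h' ∖ ℓ) Y
  agreeBelow Y⊆R = restrictEq-mono (h ∖ ℓ) (h' ∖ ℓ) Y⊆R (restrictEq-∖ h h' ℓ agree)
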